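{- Let $v\in \Sigma^+$, let $v=v_1^{p_1}\cdots v_m^{p_m}$ be the Lyndon factorization of $v$, and let $\Lambda(v)=\{s_{\lambda},\ldots,s_{m+1}\}$. If for some $w\in \bar{\Sigma}^*$ and some $i$ with $\lambda< i \le m+1$ we have $\mathrm{MinSuf}(v,w)=s_{i} w$, then $v_{i-1}s_{i} w\preceq sw$ for every non-empty suffix $s$ of $v$ satisfying $|s|>|s_{i}|$.
   Context: $\Sigma$ is a totally ordered alphabet; $\$\notin\Sigma$ is an extra letter larger than every letter of $\Sigma$, $\bar\Sigma=\Sigma\cup\{\$\}$; $\prec$ is the lexicographic order (a proper prefix is smaller). $\mathrm{MinSuf}(x,y)$ is the $\prec$-smallest string $sy$ over all (possibly empty) suffixes $s$ of $x$. A Lyndon word is a non-empty string strictly smaller than all its proper non-empty suffixes. The Lyndon factorization of $v\in\Sigma^+$ is the unique representation $v=v_1^{p_1}\cdots v_m^{p_m}$ with $p_j\ge1$ and Lyndon words $v_1\succ\cdots\succ v_m$. Set $s_j=v_j^{p_j}\cdots v_m^{p_m}$ for $1\le j\le m$ and $s_{m+1}=\varepsilon$. Let $\lambda$ be the smallest index such that $s_{j+1}$ is a prefix of $v_j$ for all $\lambda\le j\le m$, and $\Lambda(v)=\{s_\lambda,\ldots,s_{m+1}\}$. -}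

module Defs where

open import Data.Nat using (ℕ; zero; suc; _≤_; _<_; _∸_)
open import Data.List using (List; []; _∷_; _++_; length; map; concat; replicate; drop)
open import Data.Product using (Σ; ∃; _×_; _,_; proj₁; proj₂)
open import Data.Sum using (_⊎_)
open import Data.List.Relation.Unary.All using (All)
open import Data.List.Relation.Unary.Linked using (Linked)
open import Relation.Binary.PropositionalEquality using (_≡_)
open import Relation.Nullary using (¬_)

data Lex {A : Set} (_≺_ : A → A → Set) : List A → List A → Set where
  nil   : ∀ {y ys} → Lex _≺_ [] (y ∷ ys)
  here  : ∀ {x y xs ys} → x ≺ y → Lex _≺_ (x ∷ xs) (y ∷ ys)
  there : ∀ {x xs ys} → Lex _≺_ xs ys → Lex _≺_ (x ∷ xs) (x ∷ ys)

LexEq : {A : Set} (_≺_ : A → A → Set) → List A → List A → Set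
LexEq _≺_ xs ys = Lex _≺_ xs ys ⊎ xs ≡ ys

Suffix : {A : Set} → List A → List A → Set
Suffix {A} s x = Σ (List A) λ u → u ++ s ≡ x

ProperSuffix : {A : Set} → List A → List A → Set
ProperSuffix {A} s x = Σ (List A) λ u → (0 < length u) × (0 < length s) × (u ++ s ≡ x)

Prefix : {A : Set} → List A → List A → Set
Prefix {A} p x = Σ (List A) λ t → p ++ t ≡ x

module Alphabet {Σ₀ : Set} (_<ₐ_ : Σ₀ → Σ₀ → Set) where

  data Sym : Set where
    chr    : Σ₀ → Sym
    dollar : Sym

  data _<̄_ : Sym → Sym → Set where
    chr<chr : ∀ {a b} → a <ₐ b → chr a <̄ chr b
    chr<$   : ∀ {a} → chr a <̄ dollar

  _≺_ : List Σ₀ → List Σ₀ → Set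
  _≺_ = Lex _<ₐ_

  _≺̄_ : List Sym → List Sym → Set
  _≺̄_ = Lex _<̄_

  _⪯̄_ : List Sym → List Sym → Set
  _⪯̄_ = LexEq _<̄_

  emb : List Σ₀ → List Sym
  emb = map chr

  Lyndon : List Σ₀ → Set
  Lyndon w = (0 < length w) × (∀ s → ProperSuffix s w → w ≺ s)

  IsMinSuf : List Sym → List Sym → List Sym → Set
  IsMinSuf x y z = (Σ (List Sym) λ s → Suffix s x × z ≡ s ++ y)
                 × (∀ s → Suffix s x → z ⪯̄ (s ++ y))

  Fact : Set
  Fact = List (List Σ₀ × ℕ)

  pow : List Σ₀ × ℕ → List Σ₀
  pow (u , p) = concat (replicate p u)

  expand : Fact → List Σ₀
  expand fs = concat (map pow fs)

  IsLyndonFactorization : List Σ₀ → Fact → Set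
  IsLyndonFactorization v fs =
      All (λ up → Lyndon (proj₁ up) × 1 ≤ proj₂ up) fs
    × Linked (λ a b → proj₁ b ≺ proj₁ a) fs
    × expand fs ≡ v

  -- v_j (1-based; returns [] out of range 1..m, only used in range)
  word : Fact → ℕ → List Σ₀
  word []              _             = []
  word (_ ∷ _)         zero          = []
  word ((u , _) ∷ _)   (suc zero)    = u
  word (_ ∷ fs)        (suc (suc j)) = word fs (suc j)

  -- s_j = v_j^{p_j} ⋯ v_m^{p_m} (1-based, j = 1..m+1; s_{m+1} = ε)
  suf : Fact → ℕ → List Σ₀
  suf fs j = expand (drop (j ∸ 1) fs)

  LamProp : Fact → ℕ → Set
  LamProp fs k = ∀ j → k ≤ j → j ≤ length fs → Prefix (suf fs (suc j)) (word fs j)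

  IsLambda : Fact → ℕ → Set
  IsLambda fs λ₀ = (1 ≤ λ₀) × (λ₀ ≤ suc (length fs)) × LamProp fs λ₀
                 × (∀ k → 1 ≤ k → k < λ₀ → ¬ LamProp fs k)

module Submission where

-- Write i = k + 2, so that v_{i-1} = v_{k+1} and v = P · S with
-- P = v_1^{p_1} ⋯ v_{k+1}^{p_{k+1}} and S = s_i.  A suffix s of v longer than S
-- has the form s = t · S with t a non-empty suffix of P.  The key combinatorial
-- fact is that v_{k+1} "dominates" every such t: either v_{k+1} is a prefix of t,
-- or v_{k+1} ≺ t is witnessed by a mismatch inside t (relation _⊑_ below).  This
-- holds because a Lyndon word dominates each non-empty suffix of its powers, and
-- v_{k+1} ⪯ v_j for j ≤ k+1 transfers this domination to the earlier blocks.
-- Finally, if b ⊑ t and the tail S·w is ⪯ every y·S·w (y a suffix of t), which is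
-- exactly the minimality of MinSuf(v,w) = S·w, then b·S·w ⪯ t·S·w.
--
-- The hypothesis on λ is only used to know i ≥ 2.

open import Defs
open import Data.Nat using (ℕ; zero; suc; _≤_; _<_; _∸_; z≤n; s≤s)
open import Data.Nat.Properties using (m≤n+m; ≤-trans; <-irrefl)
open import Data.List using (List; []; _∷_; length; _++_; map; concat; take; drop)
open import Data.List.Properties using (map-++; length-++; concat-++; take++drop≡id; ∷-injectiveʳ; ++-assoc)
open import Data.List.Relation.Unary.All using (All; []; _∷_)
import Data.List.Relation.Unary.All as All
open import Data.List.Relation.Unary.All.Properties using (take⁺)
open import Data.List.Relation.Unary.Linked as Linked using (Linked; [-]; _∷_)
open import Data.Product using (Σ; _×_; _,_; proj₁; proj₂)
open import Data.Sum using (_⊎_; inj₁; inj₂)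
open import Data.Empty using (⊥; ⊥-elim)
open import Relation.Binary.PropositionalEquality
  using (_≡_; refl; sym; trans; cong; subst; subst₂; module ≡-Reasoning)
open import Relation.Binary.Structures using (IsStrictTotalOrder)
open import Relation.Binary.Definitions using (Transitive)

suffix-++ : ∀ {A : Set} (a b x : List A) → Suffix x (a ++ b) →
  (Σ (List A) λ t → Suffix t a × 0 < length t × x ≡ t ++ b) ⊎ Suffix x b
suffix-++ []      b x (u , eq)      = inj₂ (u , eq)
suffix-++ (c ∷ a) b x ([] , eq)     = inj₁ (c ∷ a , ([] , refl) , s≤s z≤n , eq)
suffix-++ (c ∷ a) b x (d ∷ u , eq) with suffix-++ a b x (u , ∷-injectiveʳ eq)
... | inj₁ (t , (u′ , e) , t≢[] , x≡t++b) = inj₁ (t , (c ∷ u′ , cong (c ∷_) e) , t≢[] , x≡t++b)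
... | inj₂ x-suf-b = inj₂ x-suf-b

suffix-length : ∀ {A : Set} {x b : List A} → Suffix x b → length x ≤ length b
suffix-length {x = x} (u , refl) =
  subst (length x ≤_) (sym (length-++ u)) (m≤n+m (length x) (length u))

suffix-[] : ∀ {A : Set} {x : List A} → Suffix x [] → 0 < length x → ⊥
suffix-[] x-suf-[] 0<|x| with ≤-trans 0<|x| (suffix-length x-suf-[])
... | ()

suffix-append : ∀ {A : Set} {y t S v : List A} →
  Suffix y t → Suffix (t ++ S) v → Suffix (y ++ S) v
suffix-append {y = y} {S = S} (u′ , refl) (u , refl) = u ++ u′ , (begin
  (u ++ u′) ++ y ++ S   ≡⟨ ++-assoc u u′ (y ++ S) ⟩
  u ++ u′ ++ y ++ S     ≡⟨ cong (u ++_) (sym (++-assoc u′ y S)) ⟩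
  u ++ (u′ ++ y) ++ S   ∎)
  where open ≡-Reasoning

module Domination {Σ₀ : Set} (_<ₐ_ : Σ₀ → Σ₀ → Set) (<ₐ-trans : Transitive _<ₐ_) where
  open Alphabet _<ₐ_

  -- b ⊑ x : b is a prefix of x, or b and x first differ at a position inside
  -- both words where b carries the smaller letter.  Unlike b ⪯ x, this survives
  -- arbitrary extensions of x.
  data _⊑_ : List Σ₀ → List Σ₀ → Set where
    prefix   : ∀ {x} → [] ⊑ x
    mismatch : ∀ {a b as bs} → a <ₐ b → (a ∷ as) ⊑ (b ∷ bs)
    keep     : ∀ {c as bs} → as ⊑ bs → (c ∷ as) ⊑ (c ∷ bs)

  ⊑-refl : ∀ a → a ⊑ a
  ⊑-refl []      = prefix
  ⊑-refl (c ∷ a) = keep (⊑-refl a)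

  ⊑-++ʳ : ∀ {a x} → a ⊑ x → ∀ z → a ⊑ (x ++ z)
  ⊑-++ʳ prefix       z = prefix
  ⊑-++ʳ (mismatch p) z = mismatch p
  ⊑-++ʳ (keep a⊑x)   z = keep (⊑-++ʳ a⊑x z)

  ≺-trans : ∀ {a b c} → a ≺ b → b ≺ c → a ≺ c
  ≺-trans nil       (here _)  = nil
  ≺-trans nil       (there _) = nil
  ≺-trans (here p)  (here q)  = here (<ₐ-trans p q)
  ≺-trans (here p)  (there _) = here p
  ≺-trans (there _) (here q)  = here q
  ≺-trans (there l) (there m) = there (≺-trans l m)

  ≺-⊑-trans : ∀ {b a y} → b ≺ a → a ⊑ y → b ⊑ y
  ≺-⊑-trans nil        _            = prefix
  ≺-⊑-trans (here p)   (mismatch q) = mismatch (<ₐ-trans p q)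
  ≺-⊑-trans (here p)   (keep _)     = mismatch p
  ≺-⊑-trans (there _)  (mismatch q) = mismatch q
  ≺-⊑-trans (there l)  (keep a⊑y)   = keep (≺-⊑-trans l a⊑y)

  ⪯-⊑-trans : ∀ {b a y} → LexEq _<ₐ_ b a → a ⊑ y → b ⊑ y
  ⪯-⊑-trans (inj₁ b≺a) a⊑y = ≺-⊑-trans b≺a a⊑y
  ⪯-⊑-trans (inj₂ refl) a⊑y = a⊑y

  ≺-shorter⇒⊑ : ∀ {a t} → a ≺ t → length t < length a → a ⊑ t
  ≺-shorter⇒⊑ nil       ()
  ≺-shorter⇒⊑ (here p)  _             = mismatch p
  ≺-shorter⇒⊑ (there l) (s≤s |t|<|a|) = keep (≺-shorter⇒⊑ l |t|<|a|)

  lyndon-⊑-suffix : ∀ {u} → Lyndon u → ∀ t → Suffix t u → 0 < length t → u ⊑ t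
  lyndon-⊑-suffix lyn t ([] , refl) _ = ⊑-refl t
  lyndon-⊑-suffix lyn t (c ∷ r , refl) 0<|t| =
    ≺-shorter⇒⊑ (proj₂ lyn t (c ∷ r , s≤s z≤n , 0<|t| , refl))
      (subst (length t <_) (sym (length-++ (c ∷ r))) (s≤s (m≤n+m (length t) (length r))))

  lyndon-⊑-power-suffix : ∀ {u} → Lyndon u → ∀ p t →
    Suffix t (pow (u , p)) → 0 < length t → u ⊑ t
  lyndon-⊑-power-suffix lyn zero t t-suf 0<|t| = ⊥-elim (suffix-[] t-suf 0<|t|)
  lyndon-⊑-power-suffix {u} lyn (suc p) t t-suf 0<|t|
    with suffix-++ u (pow (u , p)) t t-suf
  ... | inj₁ (t′ , t′-suf , 0<|t′| , refl) = ⊑-++ʳ (lyndon-⊑-suffix lyn t′ t′-suf 0<|t′|) _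
  ... | inj₂ t-suf′ = lyndon-⊑-power-suffix lyn p t t-suf′ 0<|t|

  ⊑-suffix-of-product : ∀ b gs →
    All (λ up → Lyndon (proj₁ up)) gs → All (λ up → LexEq _<ₐ_ b (proj₁ up)) gs →
    ∀ x → Suffix x (expand gs) → 0 < length x → b ⊑ x
  ⊑-suffix-of-product b [] _ _ x x-suf 0<|x| = ⊥-elim (suffix-[] x-suf 0<|x|)
  ⊑-suffix-of-product b ((u , p) ∷ gs) (lyn ∷ lyns) (b⪯u ∷ b⪯gs) x x-suf 0<|x|
    with suffix-++ (pow (u , p)) (expand gs) x x-suf
  ... | inj₁ (t , t-suf , 0<|t| , refl) =
    ⊑-++ʳ (⪯-⊑-trans b⪯u (lyndon-⊑-power-suffix lyn p t t-suf 0<|t|)) _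
  ... | inj₂ x-suf′ = ⊑-suffix-of-product b gs lyns b⪯gs x x-suf′ 0<|x|

  Decreasing : List (List Σ₀ × ℕ) → Set
  Decreasing = Linked (λ a b → proj₁ b ≺ proj₁ a)

  below-head : ∀ {g gs} → Decreasing (g ∷ gs) → All (λ up → proj₁ up ≺ proj₁ g) gs
  below-head [-]          = []
  below-head (h≺g ∷ rest) = h≺g ∷ All.map (λ k≺h → ≺-trans k≺h h≺g) (below-head rest)

  word-All : ∀ {Q : List Σ₀ → Set} gs k → All (λ up → Q (proj₁ up)) gs →
    1 ≤ k → k ≤ length gs → Q (word gs k)
  word-All (g ∷ gs) (suc zero)    (q ∷ _)  _ _        = q
  word-All (g ∷ gs) (suc (suc k)) (_ ∷ qs) _ (s≤s le) = word-All gs (suc k) qs (s≤s z≤n) le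

  word-⪯-earlier : ∀ fs n → Decreasing fs → 1 ≤ n → n ≤ length fs →
    All (λ up → LexEq _<ₐ_ (word fs n) (proj₁ up)) (take n fs)
  word-⪯-earlier (g ∷ gs) (suc zero) _ _ _ = inj₂ refl ∷ []
  word-⪯-earlier (g ∷ gs) (suc (suc k)) dec _ (s≤s le) =
    inj₁ (word-All gs (suc k) (below-head dec) (s≤s z≤n) le)
    ∷ word-⪯-earlier gs (suc k) (Linked.tail dec) (s≤s z≤n) le

  factor-⊑-suffix : ∀ fs n → All (λ up → Lyndon (proj₁ up) × 1 ≤ proj₂ up) fs →
    Decreasing fs → 1 ≤ n → n ≤ length fs →
    ∀ x → Suffix x (expand (take n fs)) → 0 < length x → word fs n ⊑ x
  factor-⊑-suffix fs n good dec 1≤n n≤m =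
    ⊑-suffix-of-product (word fs n) (take n fs)
      (take⁺ n (All.map proj₁ good))
      (word-⪯-earlier fs n dec 1≤n n≤m)

  emb-++-++ : ∀ a b (w : List Sym) → emb (a ++ b) ++ w ≡ emb a ++ (emb b ++ w)
  emb-++-++ a b w = trans (cong (_++ w) (map-++ chr a b)) (++-assoc (emb a) (emb b) w)

  emb-suffix : ∀ {y v} → Suffix y v → Suffix (emb y) (emb v)
  emb-suffix (u , refl) = emb u , sym (map-++ chr u _)

  ⊑-minimal-tail : ∀ (τ : List Sym) {b x} → b ⊑ x →
    (∀ y → Suffix y x → τ ⪯̄ (emb y ++ τ)) → (emb b ++ τ) ⪯̄ (emb x ++ τ)
  ⊑-minimal-tail τ {x = x} prefix τ-min = τ-min x ([] , refl)
  ⊑-minimal-tail τ (mismatch p) _ = inj₁ (here (chr<chr p))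
  ⊑-minimal-tail τ {c ∷ _} (keep b⊑x) τ-min
    with ⊑-minimal-tail τ b⊑x (λ y (u , e) → τ-min y (c ∷ u , cong (c ∷_) e))
  ... | inj₁ lt = inj₁ (there lt)
  ... | inj₂ eq = inj₂ (cong (chr c ∷_) eq)

  ⊑-below-long-suffixes : ∀ (P S : List Σ₀) (w : List Sym) b →
    IsMinSuf (emb (P ++ S)) w (emb S ++ w) →
    (∀ t → Suffix t P → 0 < length t → b ⊑ t) →
    ∀ s → Suffix s (P ++ S) → length S < length s → (emb (b ++ S) ++ w) ⪯̄ (emb s ++ w)
  ⊑-below-long-suffixes P S w b min b⊑ s s-suf |S|<|s| with suffix-++ P S s s-suf
  ... | inj₂ s-suf-S = ⊥-elim (<-irrefl refl (≤-trans |S|<|s| (suffix-length s-suf-S)))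
  ... | inj₁ (t , t-suf , 0<|t| , refl) =
    subst₂ _⪯̄_ (sym (emb-++-++ b S w)) (sym (emb-++-++ t S w))
      (⊑-minimal-tail (emb S ++ w) (b⊑ t t-suf 0<|t|) S·w-minimal)
    where
      S·w-minimal : ∀ y → Suffix y t → (emb S ++ w) ⪯̄ (emb y ++ (emb S ++ w))
      S·w-minimal y y-suf = subst (_ ⪯̄_) (emb-++-++ y S w)
        (proj₂ min (emb (y ++ S)) (emb-suffix (suffix-append y-suf s-suf)))

  expand-split : ∀ n fs → expand fs ≡ expand (take n fs) ++ expand (drop n fs)
  expand-split n fs = begin
    expand fs                                              ≡⟨ cong expand (sym (take++drop≡id n fs)) ⟩
    concat (map pow (take n fs ++ drop n fs))              ≡⟨ cong concat (map-++ pow (take n fs) (drop n fs)) ⟩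
    concat (map pow (take n fs) ++ map pow (drop n fs))    ≡⟨ sym (concat-++ (map pow (take n fs)) (map pow (drop n fs))) ⟩
    expand (take n fs) ++ expand (drop n fs)               ∎
    where open ≡-Reasoning

lemma13 : (Σ₀ : Set) (_<ₐ_ : Σ₀ → Σ₀ → Set) → IsStrictTotalOrder _≡_ _<ₐ_ →
    let open Alphabet _<ₐ_ in
    (v : List Σ₀) → 0 < length v →
    (fs : Fact) → IsLyndonFactorization v fs →
    (λ₀ : ℕ) → IsLambda fs λ₀ →
    (w : List Sym) (i : ℕ) → λ₀ < i → i ≤ suc (length fs) →
    IsMinSuf (emb v) w (emb (suf fs i) ++ w) →
    (s : List Σ₀) → Suffix s v → 0 < length s → length (suf fs i) < length s →
    (emb (word fs (i ∸ 1) ++ suf fs i) ++ w) ⪯̄ (emb s ++ w)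
-- i ≥ 2 because 1 ≤ λ₀ < i.
lemma13 _ _ _ _ _ _ _ _ _ _ zero () _ _ _ _ _ _
lemma13 _ _ _ _ _ _ _ .0 (() , _) _ (suc zero) (s≤s z≤n) _ _ _ _ _ _
lemma13 Σ₀ _<ₐ_ sto _ _ fs (good , dec , refl) _ _ w (suc (suc k)) _ (s≤s k<m) min s s-suf _ |sᵢ|<|s| =
  ⊑-below-long-suffixes P S w (word fs (suc k))
    (subst (λ v → IsMinSuf (emb v) w (emb S ++ w)) split min)
    (factor-⊑-suffix fs (suc k) good dec (s≤s z≤n) k<m)
    s (subst (Suffix s) split s-suf) |sᵢ|<|s|
  where
    open Alphabet _<ₐ_
    open Domination _<ₐ_ (IsStrictTotalOrder.trans sto)
    P = expand (take (suc k) fs)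
    S = expand (drop (suc k) fs)
    split : expand fs ≡ P ++ S
    split = expand-split (suc k) fs
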